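{- Fix an integer $k$ and a class $\mathcal{C}$ of graphs such that $\chi(G)=k$ for all $G\in\mathcal{C}$, and let $A_1$ be a classical (prediction-free) deterministic online coloring algorithm that produces a proper coloring on every online graph whose underlying graph lies in $\mathcal{C}$. Then there exists an online coloring algorithm $A'$ with predictions (which may use knowledge of $k$ and $\mathcal{C}$) such that for every online graph with predictions $(G,\pi,P)$ with $G\in\mathcal{C}$: $A'(G)\le 3\min\{\textsc{FFP}(G),A_1(G)\}$ if $\eta(G)>0$, and $A'(G)=k$ if $\eta(G)=0$.
   Context: An online graph with predictions $(G,\pi,P)$ consists of a finite graph $G=(V,E)$, an ordering $\pi$ of $V$ in which vertices are revealed one by one (with adjacencies to earlier vertices), and a map $P:V\to\mathcal{U}$ of predicted colors revealed with the vertices; $\mathcal{U}$ is an infinite universe of colors. An online coloring algorithm irrevocably assigns each arriving vertex a color, depending only on the information revealed so far, keeping the coloring proper; $B(G)$ is the number of distinct colors algorithm $B$ uses on $(G,\pi,P)$. The prediction error is $\eta(G)=\min_O|\{v:P(v)\ne O(v)\}|$ over all proper colorings $O:V\to\mathcal{U}$ using exactly $\chi(G)$ colors. $\textsc{FFP}$ (\textsc{FirstFitPredictions}): for each predicted color $c$ there is a palette $C(c)=\{c^0,c^1,\dots\}$ ordered by superscript, palettes of distinct predicted colors pairwise disjoint; an arriving vertex $v$ with $P(v)=c$ receives the smallest-superscript color of $C(c)$ not assigned to a previously revealed neighbor of $v$. -}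

module Defs where

open import Data.Bool using (Bool; true; false; if_then_else_)
open import Data.Nat using (ℕ; zero; suc; _≤_; _<_)
open import Data.Nat.Properties using () renaming (_≟_ to _≟ℕ_)
open import Data.Fin using (Fin; toℕ)
open import Data.Fin.Permutation using (Permutation′; _⟨$⟩ʳ_)
open import Data.List using (List; []; _∷_; _++_; [_]; map; take; allFin; length; deduplicate; filter; zip)
open import Data.List.Membership.DecPropositional _≟ℕ_ using (_∈?_)
open import Data.Maybe using (Maybe; just; nothing)
open import Data.Product using (Σ; _×_; _,_; ∃)
open import Data.Product.Properties using (≡-dec)
open import Relation.Nullary using (¬_; ¬?; does)
open import Relation.Binary.PropositionalEquality using (_≡_; _≢_)
open import Relation.Binary.Definitions using (DecidableEquality)

record Graph (n : ℕ) : Set where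
  field
    adj    : Fin n → Fin n → Bool
    sym    : ∀ u v → adj u v ≡ adj v u
    irrefl : ∀ v → adj v v ≡ false
open Graph public

GraphClass : Set₁
GraphClass = (n : ℕ) → Graph n → Set

numColors : {X : Set} → DecidableEquality X → {n : ℕ} → (Fin n → X) → ℕ
numColors _≟_ {n} c = length (deduplicate _≟_ (map c (allFin n)))

Proper : {X : Set} {n : ℕ} → Graph n → (Fin n → X) → Set
Proper G c = ∀ u v → adj G u v ≡ true → c u ≢ c v

IsChromatic : {n : ℕ} → Graph n → ℕ → Set
IsChromatic G k =
  (Σ (Fin _ → ℕ) λ c → Proper G c × numColors _≟ℕ_ c ≡ k)
  × (∀ (c : Fin _ → ℕ) → Proper G c → k ≤ numColors _≟ℕ_ c)

OptimalColoring : {n : ℕ} → Graph n → (Fin n → ℕ) → Set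
OptimalColoring G O = Proper G O × IsChromatic G (numColors _≟ℕ_ O)

mismatches : {n : ℕ} → (Fin n → ℕ) → (Fin n → ℕ) → ℕ
mismatches {n} P O = length (filter (λ v → ¬? (P v ≟ℕ O v)) (allFin n))

IsEta : {n : ℕ} → Graph n → (Fin n → ℕ) → ℕ → Set
IsEta G P e =
  (Σ (Fin _ → ℕ) λ O → OptimalColoring G O × mismatches P O ≡ e)
  × (∀ O → OptimalColoring G O → e ≤ mismatches P O)

-- Vertex π(t) is revealed at time t (t = 0,1,…,n-1).
-- At time t the algorithm learns the list of adjacencies (Bool) of the new
-- vertex to the vertices revealed at times 0,…,t-1 (in this order), and,
-- in the prediction setting, its predicted colour.

RevealP : Set
RevealP = List Bool × ℕ

Reveal : Set
Reveal = List Bool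

-- A deterministic online algorithm maps the sequence of everything
-- revealed so far (in reveal order, ending with the current vertex)
-- to the colour of the current vertex.
AlgP : Set → Set
AlgP X = List RevealP → X

Alg : Set → Set
Alg X = List Reveal → X

earlier : {n : ℕ} → Fin n → List (Fin n)
earlier {n} t = take (toℕ t) (allFin n)

revealAt : {n : ℕ} → Graph n → Permutation′ n → Fin n → Reveal
revealAt G π t = map (λ s → adj G (π ⟨$⟩ʳ t) (π ⟨$⟩ʳ s)) (earlier t)

inputP : {n : ℕ} → Graph n → Permutation′ n → (Fin n → ℕ) → List RevealP
inputP {n} G π P = map (λ t → revealAt G π t , P (π ⟨$⟩ʳ t)) (allFin n)

input : {n : ℕ} → Graph n → Permutation′ n → List Reveal
input {n} G π = map (revealAt G π) (allFin n)

runP : {X : Set} {n : ℕ} → AlgP X → Graph n → Permutation′ n → (Fin n → ℕ) → Fin n → X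
runP A G π P t = A (take (suc (toℕ t)) (inputP G π P))

run : {X : Set} {n : ℕ} → Alg X → Graph n → Permutation′ n → Fin n → X
run A G π t = A (take (suc (toℕ t)) (input G π))

-- the produced colouring is proper on G (vertex π t gets colour col t)
ProperOnline : {X : Set} {n : ℕ} → Graph n → Permutation′ n → (Fin n → X) → Set
ProperOnline G π col = ∀ s t → adj G (π ⟨$⟩ʳ s) (π ⟨$⟩ʳ t) ≡ true → col s ≢ col t

-- FirstFitPredictions.  Colour c^j of palette C(c) is encoded as (c , j);
-- palettes of distinct predicted colours are thus disjoint.

mex : List ℕ → ℕ
mex xs = go (length xs) 0
  where
  go : ℕ → ℕ → ℕ
  go zero    j = j
  go (suc f) j = if does (j ∈? xs) then go f (suc j) else j

nbrColors : List (ℕ × ℕ) → List Bool → List (ℕ × ℕ)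
nbrColors (x ∷ xs) (true  ∷ bs) = x ∷ nbrColors xs bs
nbrColors (x ∷ xs) (false ∷ bs) = nbrColors xs bs
nbrColors _        _            = []

usedIdx : ℕ → List (ℕ × ℕ) → List ℕ
usedIdx c []             = []
usedIdx c ((c' , j) ∷ ys) = if does (c' ≟ℕ c) then j ∷ usedIdx c ys else usedIdx c ys

ffpStep : List (ℕ × ℕ) → RevealP → ℕ × ℕ
ffpStep prev (bs , c) = c , mex (usedIdx c (nbrColors prev bs))

ffpRun : List (ℕ × ℕ) → List RevealP → List (ℕ × ℕ)
ffpRun acc []       = acc
ffpRun acc (r ∷ rs) = ffpRun (acc ++ [ ffpStep acc r ]) rs

FFP : AlgP (ℕ × ℕ)
FFP rs with Data.List.last (ffpRun [] rs)
... | just x  = x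
... | nothing = 0 , 0

decℕ×ℕ : DecidableEquality (ℕ × ℕ)
decℕ×ℕ = ≡-dec _≟ℕ_ _≟ℕ_

module Submission where

-- A′ runs FFP and A₁ side by side on the revealed input and colours each
-- vertex by one of three rules, tagging the colour with the rule used: the
-- predicted colour, while FFP gives the vertex superscript 0 and at most k
-- predicted colours have appeared (adjacent such vertices cannot share a
-- prediction, or FFP would have raised the later superscript); otherwise FFP's
-- colour if FFP has so far used no more colours than A₁; otherwise A₁'s colour.
-- Each rule contributes at most min(FFP, A₁) colours.  The first uses at most
-- k, which is at most min(FFP, A₁) as both colour G properly.  Every vertex
-- coloured by one of the other rules arrived by the last time t that rule
-- fired, and at time t the algorithm it copies had used no more colours than
-- the other one.  When η = 0 the predictions are an optimal colouring, FFP
-- never leaves superscript 0, so the first rule always fires and exactly k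
-- colours are used.

open import Defs hiding (sym)
open import Data.Bool using (Bool; true; false; T; if_then_else_)
open import Data.Empty using (⊥-elim)
open import Data.Fin using (Fin; toℕ)
open import Data.Fin.Permutation using (Permutation′; _⟨$⟩ʳ_; _⟨$⟩ˡ_; inverseʳ)
open import Data.Fin.Properties using (toℕ-injective)
open import Data.List using (List; []; _∷_; _++_; [_]; _∷ʳ_; map; length; deduplicate; filter; take; tabulate; allFin; upTo; last)
open import Data.List.Extrema.Nat using (argmax; argmax-all; f[⊥]≤f[argmax]; f[xs]≤f[argmax])
open import Data.List.Membership.Propositional using (_∈_; _∉_)
open import Data.List.Membership.Propositional.Properties
  using (∈-map⁺; ∈-map⁻; ∈-++⁺ˡ; ∈-++⁺ʳ; ∈-++⁻; ∈-filter⁺; ∈-deduplicate⁺; ∈-deduplicate⁻; ∈-upTo⁻; ∈-allFin; ∈-length)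
open import Data.List.Properties
  using (length-++; length-map; length-upTo; map-∘; map-++; map-cong; tabulate-cong; take-map; map-tabulate; take-suc-tabulate; filter-notAll)
open import Data.List.Relation.Binary.Subset.Propositional using (_⊆_)
open import Data.List.Relation.Binary.Subset.Propositional.Properties using (map⁺)
open import Data.List.Relation.Unary.All as All using (All; []; _∷_)
open import Data.List.Relation.Unary.All.Properties using (all-filter)
open import Data.List.Relation.Unary.AllPairs using ([]; _∷_)
open import Data.List.Relation.Unary.Any as Any using (here; there)
open import Data.List.Relation.Unary.Unique.DecPropositional.Properties using (deduplicate-!)
open import Data.List.Relation.Unary.Unique.Propositional using (Unique)
open import Data.List.Relation.Unary.Unique.Propositional.Properties using (upTo⁺)
open import Data.List.Reverse using (Reverse; reverseView; []; _∶_∶ʳ_)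
open import Data.Maybe using (just)
open import Data.Nat using (ℕ; zero; suc; _≤_; _<_; _+_; _*_; _⊓_; _≡ᵇ_; z≤n; s≤s; s≤s⁻¹)
open import Data.Nat.Properties
open import Data.Nat.Properties using () renaming (_≟_ to _≟ℕ_)
open import Data.List.Membership.DecPropositional _≟ℕ_ using (_∈?_)
open import Data.Product using (Σ; ∃; _×_; _,_; proj₁; proj₂)
import Data.Product as Product
open import Data.Sum using (inj₁; inj₂)
open import Function using (_∘_; id)
open import Relation.Binary using (tri<; tri≈; tri>)
open import Relation.Binary.Definitions using (DecidableEquality)
open import Relation.Binary.PropositionalEquality
  using (_≡_; _≢_; refl; sym; trans; cong; cong₂; subst; subst₂; module ≡-Reasoning)
open import Relation.Nullary using (¬_; ¬?; Dec; yes; no; does; contradiction)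
open import Relation.Nullary.Decidable using (map′; _×-dec_)

module Distinct {A : Set} (_≟_ : DecidableEquality A) where

  distinct : List A → ℕ
  distinct xs = length (deduplicate _≟_ xs)

  Unique⇒length≤ : ∀ {xs ys} → Unique xs → xs ⊆ ys → length xs ≤ length ys
  Unique⇒length≤ {[]} _ _ = z≤n
  Unique⇒length≤ {x ∷ xs} {ys} (x∉xs ∷ !xs) xs⊆ys = begin-strict
    length xs              ≤⟨ Unique⇒length≤ !xs xs⊆ys-x ⟩
    length (filter ≢x? ys) <⟨ filter-notAll ≢x? ys (Any.map (λ x≡y x≢y → x≢y x≡y) (xs⊆ys (here refl))) ⟩
    length ys              ∎
    where
    open ≤-Reasoning
    ≢x? = λ y → ¬? (x ≟ y)
    xs⊆ys-x : xs ⊆ filter ≢x? ys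
    xs⊆ys-x z∈xs = ∈-filter⁺ ≢x? (xs⊆ys (there z∈xs)) (All.lookup x∉xs z∈xs)

  distinct-mono : ∀ {xs ys} → xs ⊆ ys → distinct xs ≤ distinct ys
  distinct-mono {xs} xs⊆ys =
    Unique⇒length≤ (deduplicate-! _≟_ xs) (∈-deduplicate⁺ _≟_ ∘ xs⊆ys ∘ ∈-deduplicate⁻ _≟_ xs)

  distinct-++ : ∀ xs ys → distinct (xs ++ ys) ≤ distinct xs + distinct ys
  distinct-++ xs ys = begin
    distinct (xs ++ ys)         ≤⟨ Unique⇒length≤ (deduplicate-! _≟_ (xs ++ ys)) split ⟩
    length (dedup xs ++ dedup ys) ≡⟨ length-++ (dedup xs) ⟩
    distinct xs + distinct ys   ∎
    where
    open ≤-Reasoning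
    dedup = deduplicate _≟_
    split : dedup (xs ++ ys) ⊆ dedup xs ++ dedup ys
    split z∈ with ∈-++⁻ xs (∈-deduplicate⁻ _≟_ (xs ++ ys) z∈)
    ... | inj₁ z∈xs = ∈-++⁺ˡ (∈-deduplicate⁺ _≟_ z∈xs)
    ... | inj₂ z∈ys = ∈-++⁺ʳ (dedup xs) (∈-deduplicate⁺ _≟_ z∈ys)

open Distinct using (distinct; distinct-mono; distinct-++)

distinct-map-factor : ∀ {X B C : Set} (_≟B_ : DecidableEquality B) (_≟C_ : DecidableEquality C)
  {f : X → C} (g : X → B) (h : B → C) (xs : List X) →
  (∀ {x} → x ∈ xs → f x ≡ h (g x)) → distinct _≟C_ (map f xs) ≤ distinct _≟B_ (map g xs)
distinct-map-factor _≟B_ _≟C_ {f} g h xs f≡h∘g = begin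
  distinct _≟C_ (map f xs)        ≤⟨ Distinct.Unique⇒length≤ _≟C_ (deduplicate-! _≟C_ (map f xs)) through-h ⟩
  length (map h (dedup (map g xs))) ≡⟨ length-map h (dedup (map g xs)) ⟩
  distinct _≟B_ (map g xs)        ∎
  where
  open ≤-Reasoning
  dedup = deduplicate _≟B_
  through-h : deduplicate _≟C_ (map f xs) ⊆ map h (dedup (map g xs))
  through-h y∈ with ∈-map⁻ f (∈-deduplicate⁻ _≟C_ (map f xs) y∈)
  ... | x , x∈xs , refl =
    subst (_∈ _) (sym (f≡h∘g x∈xs)) (∈-map⁺ h (∈-deduplicate⁺ _≟B_ (∈-map⁺ g x∈xs)))

take-⊆ : ∀ {A : Set} m (xs : List A) → take m xs ⊆ xs
take-⊆ (suc m) (x ∷ xs) (here refl) = here refl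
take-⊆ (suc m) (x ∷ xs) (there p)   = there (take-⊆ m xs p)

∈-take-tabulate : ∀ {A : Set} {n m} (f : Fin n → A) {i} → toℕ i < m → f i ∈ take m (tabulate f)
∈-take-tabulate {n = suc n} {suc m} f {Fin.zero}  _           = here refl
∈-take-tabulate {n = suc n} {suc m} f {Fin.suc i} (s≤s i<m) = there (∈-take-tabulate (f ∘ Fin.suc) i<m)

colours-up-to : ∀ {A : Set} {n} → (Fin n → A) → Fin n → List A
colours-up-to f t = take (suc (toℕ t)) (tabulate f)

distinct-map≤numColors : ∀ {A : Set} (_≟_ : DecidableEquality A) {n} (f : Fin n → A) ts →
  distinct _≟_ (map f ts) ≤ numColors _≟_ f
distinct-map≤numColors _≟_ {n} f ts = distinct-mono _≟_ {map f ts} {map f (allFin n)} (map⁺ f λ {t} _ → ∈-allFin t)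

distinct-up-to≤numColors : ∀ {A : Set} (_≟_ : DecidableEquality A) {n} (f : Fin n → A) t →
  distinct _≟_ (colours-up-to f t) ≤ numColors _≟_ f
distinct-up-to≤numColors _≟_ f t =
  distinct-mono _≟_ λ y∈ → subst (_ ∈_) (sym (map-tabulate id f)) (take-⊆ (suc (toℕ t)) (tabulate f) y∈)

numColors-∘-≤ : ∀ {X : Set} (_≟_ : DecidableEquality X) {n} (col : Fin n → X) (σ : Fin n → Fin n) →
  numColors _≟_ (col ∘ σ) ≤ numColors _≟_ col
numColors-∘-≤ _≟_ col σ = distinct-mono _≟_ through-σ
  where
  through-σ : map (col ∘ σ) (allFin _) ⊆ map col (allFin _)
  through-σ y∈ with ∈-map⁻ (col ∘ σ) y∈
  ... | v , _ , refl = ∈-map⁺ col (∈-allFin (σ v))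

distinct-≤-latest : ∀ {C : Set} (_≟_ : DecidableEquality C) {n} (f : Fin n → C) {M : Fin n → Set} {B} →
  (∀ t → M t → distinct _≟_ (colours-up-to f t) ≤ B) →
  ∀ {ts} → All M ts → distinct _≟_ (map f ts) ≤ B
distinct-≤-latest _≟_ f bound {[]} [] = z≤n
distinct-≤-latest _≟_ f bound {t ∷ ts} (Mt ∷ Mts) =
  ≤-trans (distinct-mono _≟_ up-to-latest) (bound latest (argmax-all toℕ Mt Mts))
  where
  latest = argmax toℕ t ts
  up-to-latest : map f (t ∷ ts) ⊆ colours-up-to f latest
  up-to-latest y∈ with ∈-map⁻ f y∈
  ... | s , here refl , refl = ∈-take-tabulate f (s≤s (f[⊥]≤f[argmax] {f = toℕ} t ts))
  ... | s , there s∈ , refl = ∈-take-tabulate f (s≤s (All.lookup (f[xs]≤f[argmax] {f = toℕ} t ts) s∈))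

MexLoop : List ℕ → (ℕ → ℕ → ℕ) → Set
MexLoop xs go = (∀ j → go 0 j ≡ j) × (∀ f j → go (suc f) j ≡ (if does (j ∈? xs) then go f (suc j) else j))

-- The loop of mex is local to its definition; with-abstracting its two
-- arguments lets unification recover it as a function.
mex-loop : ∀ xs → Σ (ℕ → ℕ → ℕ) λ go → MexLoop xs go × mex xs ≡ go (length xs) 0
mex-loop xs = go , ((λ _ → refl) , (λ _ _ → refl)) , mex≡go
  where
  go : ℕ → ℕ → ℕ
  go = _
  mex≡go : mex xs ≡ go (length xs) 0
  mex≡go with length xs
  ... | n with 0
  ... | j = refl

loop-hit⇒prefix : ∀ {xs go} → MexLoop xs go → ∀ f j → (∀ i → i < j → i ∈ xs) →
  go f j ∈ xs → ∀ i → i ≤ f + j → i ∈ xs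
loop-hit⇒prefix {xs} (stop , step) zero j below hit i i≤j with m≤n⇒m<n∨m≡n i≤j
... | inj₁ i<j  = below i i<j
... | inj₂ refl = subst (_∈ xs) (stop i) hit
loop-hit⇒prefix {xs} {go} (stop , step) (suc f) j below hit i i≤ with j ∈? xs | step f j
... | yes j∈ | go≡ = loop-hit⇒prefix {go = go} (stop , step) f (suc j) below′ (subst (_∈ xs) go≡ hit) i
                       (subst (i ≤_) (sym (+-suc f j)) i≤)
  where
  below′ : ∀ i → i < suc j → i ∈ xs
  below′ i (s≤s i≤j) with m≤n⇒m<n∨m≡n i≤j
  ... | inj₁ i<j  = below i i<j
  ... | inj₂ refl = j∈
... | no j∉ | go≡ = contradiction (subst (_∈ xs) go≡ hit) j∉

mex-∉ : ∀ xs → mex xs ∉ xs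
mex-∉ xs mex∈ with mex-loop xs
... | go , loop , mex≡go = 1+n≰n (begin
  suc (length xs)            ≡⟨ sym (length-upTo (suc (length xs))) ⟩
  length (upTo (suc (length xs))) ≤⟨ Distinct.Unique⇒length≤ _≟_ (upTo⁺ _) upTo⊆xs ⟩
  length xs                  ∎)
  where
  open ≤-Reasoning
  upTo⊆xs : upTo (suc (length xs)) ⊆ xs
  upTo⊆xs {i} i∈ = loop-hit⇒prefix {go = go} loop (length xs) 0 (λ _ ()) (subst (_∈ xs) mex≡go mex∈) i
    (subst (i ≤_) (sym (+-identityʳ _)) (s≤s⁻¹ (∈-upTo⁻ i∈)))

triangle : ℕ → ℕ
triangle zero    = 0
triangle (suc n) = suc n + triangle n

triangle-mono : ∀ {m n} → m ≤ n → triangle m ≤ triangle n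
triangle-mono z≤n       = z≤n
triangle-mono (s≤s m≤n) = +-mono-≤ (s≤s m≤n) (triangle-mono m≤n)

cantor : ℕ × ℕ → ℕ
cantor (a , b) = triangle (a + b) + a

cantor-< : ∀ {a b c d} → a + b < c + d → cantor (a , b) < cantor (c , d)
cantor-< {a} {b} {c} {d} a+b<c+d = begin-strict
  triangle (a + b) + a       ≤⟨ +-monoʳ-≤ (triangle (a + b)) (m≤m+n a b) ⟩
  triangle (a + b) + (a + b) ≡⟨ +-comm (triangle (a + b)) (a + b) ⟩
  a + b + triangle (a + b)   <⟨ n<1+n _ ⟩
  triangle (suc (a + b))     ≤⟨ triangle-mono a+b<c+d ⟩
  triangle (c + d)           ≤⟨ m≤m+n (triangle (c + d)) c ⟩
  cantor (c , d)             ∎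
  where open ≤-Reasoning

cantor-injective : ∀ {p q} → cantor p ≡ cantor q → p ≡ q
cantor-injective {a , b} {c , d} eq with <-cmp (a + b) (c + d)
... | tri< lt _ _ = contradiction eq (<⇒≢ (cantor-< {a} {b} {c} {d} lt))
... | tri> _ _ gt = contradiction (sym eq) (<⇒≢ (cantor-< {c} {d} {a} {b} gt))
... | tri≈ _ a+b≡c+d _ = cong₂ _,_ a≡c (+-cancelˡ-≡ c b d (subst (λ x → x + b ≡ c + d) a≡c a+b≡c+d))
  where
  a≡c : a ≡ c
  a≡c = +-cancelˡ-≡ (triangle (a + b)) a c (trans eq (cong (λ s → triangle s + c) (sym a+b≡c+d)))

outputs : {R X : Set} → (List R → X) → List R → List X
outputs Φ []       = []
outputs Φ (r ∷ rs) = Φ [ r ] ∷ outputs (Φ ∘ (r ∷_)) rs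

module _ {R X : Set} where

  outputs-∷ʳ : ∀ (Φ : List R → X) rs r → outputs Φ (rs ∷ʳ r) ≡ outputs Φ rs ∷ʳ Φ (rs ∷ʳ r)
  outputs-∷ʳ Φ []        r = refl
  outputs-∷ʳ Φ (r′ ∷ rs) r = cong (Φ [ r′ ] ∷_) (outputs-∷ʳ (Φ ∘ (r′ ∷_)) rs r)

  outputs-take : ∀ (Φ : List R → X) m rs → outputs Φ (take m rs) ≡ take m (outputs Φ rs)
  outputs-take Φ zero    rs       = refl
  outputs-take Φ (suc m) []       = refl
  outputs-take Φ (suc m) (r ∷ rs) = cong (Φ [ r ] ∷_) (outputs-take (Φ ∘ (r ∷_)) m rs)

  outputs-tabulate : ∀ {n} (Φ : List R → X) (f : Fin n → R) →
    outputs Φ (tabulate f) ≡ tabulate (λ (i : Fin n) → Φ (take (suc (toℕ i)) (tabulate f)))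
  outputs-tabulate {zero}  Φ f = refl
  outputs-tabulate {suc n} Φ f = cong (Φ [ f Fin.zero ] ∷_) (outputs-tabulate {n} (Φ ∘ (f Fin.zero ∷_)) (f ∘ Fin.suc))

last-∷ʳ : ∀ {A : Set} (xs : List A) x → last (xs ∷ʳ x) ≡ just x
last-∷ʳ []           x = refl
last-∷ʳ (y ∷ [])     x = refl
last-∷ʳ (y ∷ z ∷ xs) x = last-∷ʳ (z ∷ xs) x

ffpRun-∷ʳ : ∀ acc rs r → ffpRun acc (rs ∷ʳ r) ≡ ffpRun acc rs ∷ʳ ffpStep (ffpRun acc rs) r
ffpRun-∷ʳ acc []        r = refl
ffpRun-∷ʳ acc (r′ ∷ rs) r = ffpRun-∷ʳ (acc ∷ʳ ffpStep acc r′) rs r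

FFP-last : ∀ {rs y} → last (ffpRun [] rs) ≡ just y → FFP rs ≡ y
FFP-last {rs} last≡ with last (ffpRun [] rs)
FFP-last refl | just _ = refl

FFP-∷ʳ : ∀ rs r → FFP (rs ∷ʳ r) ≡ ffpStep (ffpRun [] rs) r
FFP-∷ʳ rs r = FFP-last {rs ∷ʳ r} (trans (cong last (ffpRun-∷ʳ [] rs r)) (last-∷ʳ (ffpRun [] rs) _))

ffpRun≡outputs : ∀ rs → ffpRun [] rs ≡ outputs FFP rs
ffpRun≡outputs rs = along (reverseView rs)
  where
  along : ∀ {rs} → Reverse rs → ffpRun [] rs ≡ outputs FFP rs
  along [] = refl
  along (rs ∶ rev ∶ʳ r) = begin
    ffpRun [] (rs ∷ʳ r)                        ≡⟨ ffpRun-∷ʳ [] rs r ⟩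
    ffpRun [] rs ∷ʳ ffpStep (ffpRun [] rs) r   ≡⟨ cong₂ _∷ʳ_ (along rev) (sym (FFP-∷ʳ rs r)) ⟩
    outputs FFP rs ∷ʳ FFP (rs ∷ʳ r)            ≡⟨ sym (outputs-∷ʳ FFP rs r) ⟩
    outputs FFP (rs ∷ʳ r)                      ∎
    where open ≡-Reasoning

∈-usedIdx⁺ : ∀ {c j} ys → (c , j) ∈ ys → j ∈ usedIdx c ys
∈-usedIdx⁺ {c} ((c′ , j′) ∷ ys) c,j∈ with c′ ≡ᵇ c in c′≡ᵇc | c,j∈
... | true  | here refl = here refl
... | true  | there p   = there (∈-usedIdx⁺ ys p)
... | false | here refl = ⊥-elim (subst T c′≡ᵇc (≡⇒≡ᵇ c c refl))
... | false | there p   = ∈-usedIdx⁺ ys p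

usedIdx-[] : ∀ {c} ys → (∀ {y} → y ∈ ys → proj₁ y ≢ c) → usedIdx c ys ≡ []
usedIdx-[] []                   _        = refl
usedIdx-[] {c} ((c′ , j′) ∷ ys) palettes with c′ ≡ᵇ c in c′≡ᵇc
... | true  = contradiction (≡ᵇ⇒≡ c′ c (subst T (sym c′≡ᵇc) _)) (palettes (here refl))
... | false = usedIdx-[] ys (palettes ∘ there)

∈-nbrColors⁺ : ∀ {n m} (c : Fin n → ℕ × ℕ) (b : Fin n → Bool) {i} → toℕ i < m → b i ≡ true →
  c i ∈ nbrColors (take m (tabulate c)) (take m (tabulate b))
∈-nbrColors⁺ {suc n} {suc m} c b {Fin.zero} _ b0 rewrite b0 = here refl
∈-nbrColors⁺ {suc n} {suc m} c b {Fin.suc i} (s≤s i<m) bi with b Fin.zero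
... | true  = there (∈-nbrColors⁺ (c ∘ Fin.suc) (b ∘ Fin.suc) i<m bi)
... | false = ∈-nbrColors⁺ (c ∘ Fin.suc) (b ∘ Fin.suc) i<m bi

∈-nbrColors⁻ : ∀ {n m} (c : Fin n → ℕ × ℕ) (b : Fin n → Bool) {y} →
  y ∈ nbrColors (take m (tabulate c)) (take m (tabulate b)) → ∃ λ i → b i ≡ true × y ≡ c i
∈-nbrColors⁻ {suc n} {suc m} c b y∈ with b Fin.zero in b0 | y∈
... | true  | here refl = Fin.zero , b0 , refl
... | true  | there y∈′ = Product.map Fin.suc id (∈-nbrColors⁻ {m = m} (c ∘ Fin.suc) (b ∘ Fin.suc) y∈′)
... | false | y∈′       = Product.map Fin.suc id (∈-nbrColors⁻ {m = m} (c ∘ Fin.suc) (b ∘ Fin.suc) y∈′)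

module _ {n} (G : Graph n) (π : Permutation′ n) where

  ProperOnline⇒Proper : ∀ {X : Set} {col : Fin n → X} → ProperOnline G π col → Proper G (col ∘ (π ⟨$⟩ˡ_))
  ProperOnline⇒Proper proper u v uv =
    proper _ _ (subst₂ (λ a b → adj G a b ≡ true) (sym (inverseʳ π)) (sym (inverseʳ π)) uv)

  χ≤numColors : ∀ {k} {col : Fin n → ℕ} → IsChromatic G k → ProperOnline G π col → k ≤ numColors _≟_ col
  χ≤numColors {col = col} (_ , minimal) proper =
    ≤-trans (minimal (col ∘ (π ⟨$⟩ˡ_)) (ProperOnline⇒Proper proper)) (numColors-∘-≤ _≟_ col (π ⟨$⟩ˡ_))
  ProperOnline-from-earlier : ∀ {X : Set} {col : Fin n → X} →
    (∀ s t → toℕ s < toℕ t → adj G (π ⟨$⟩ʳ t) (π ⟨$⟩ʳ s) ≡ true → col s ≢ col t) →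
    ProperOnline G π col
  ProperOnline-from-earlier earlier s t st with <-cmp (toℕ s) (toℕ t)
  ... | tri< s<t _ _ = earlier s t s<t (trans (Graph.sym G _ _) st)
  ... | tri> _ _ t<s = earlier t s t<s st ∘ sym
  ... | tri≈ _ s≡t _ with toℕ-injective s≡t
  ... | refl = contradiction (trans (sym st) (irrefl G _)) λ ()

mismatches≡0⇒≗ : ∀ {n} {P O : Fin n → ℕ} → mismatches P O ≡ 0 → ∀ v → P v ≡ O v
mismatches≡0⇒≗ {P = P} {O} none v with P v ≟ O v
... | yes P≡O = P≡O
... | no  P≢O = contradiction none (>⇒≢ (∈-length (∈-filter⁺ (λ w → ¬? (P w ≟ O w)) (∈-allFin v) P≢O)))

perfect-predictions : ∀ {n k} {G : Graph n} {P O : Fin n → ℕ} →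
  IsChromatic G k → OptimalColoring G O → mismatches P O ≡ 0 → Proper G P × numColors _≟_ P ≤ k
perfect-predictions {k = k} {P = P} {O} ((c , c-proper , c≡k) , _) (O-proper , _ , O-minimal) none =
  P-proper , P-few
  where
  P≗O = mismatches≡0⇒≗ none
  P-proper : ∀ u v → _ → P u ≢ P v
  P-proper u v uv Pu≡Pv = O-proper u v uv (trans (sym (P≗O u)) (trans Pu≡Pv (P≗O v)))
  P-few : numColors _≟_ P ≤ k
  P-few = begin
    numColors _≟_ P  ≡⟨ cong (distinct _≟_) (map-cong P≗O (allFin _)) ⟩
    numColors _≟_ O  ≤⟨ O-minimal c c-proper ⟩
    numColors _≟_ c  ≡⟨ c≡k ⟩
    k                ∎
    where open ≤-Reasoning

data Mode : Set where
  usePredictions useFFP useA₁ : Mode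

index : Mode → ℕ
index usePredictions = 0
index useFFP         = 1
index useA₁          = 2

index-injective : ∀ {m m′} → index m ≡ index m′ → m ≡ m′
index-injective {usePredictions} {usePredictions} refl = refl
index-injective {useFFP}         {useFFP}         refl = refl
index-injective {useA₁}          {useA₁}          refl = refl

_≟ᴹ_ : DecidableEquality Mode
m ≟ᴹ m′ = map′ index-injective (cong index) (index m ≟ index m′)

module Combined (k : ℕ) (A₁ : Alg ℕ) where

  A₁ᴾ : AlgP ℕ
  A₁ᴾ ℓ = A₁ (map proj₁ ℓ)

  palette : AlgP ℕ
  palette ℓ = proj₁ (FFP ℓ)

  Trusted : List RevealP → Set
  Trusted ℓ = proj₂ (FFP ℓ) ≡ 0 × distinct _≟_ (outputs palette ℓ) ≤ k

  FFPCheaper : List RevealP → Set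
  FFPCheaper ℓ = distinct decℕ×ℕ (outputs FFP ℓ) ≤ distinct _≟_ (outputs A₁ᴾ ℓ)

  trusted? : ∀ ℓ → Dec (Trusted ℓ)
  trusted? ℓ = proj₂ (FFP ℓ) ≟ 0 ×-dec distinct _≟_ (outputs palette ℓ) ≤? k

  ffpCheaper? : ∀ ℓ → Dec (FFPCheaper ℓ)
  ffpCheaper? ℓ = distinct decℕ×ℕ (outputs FFP ℓ) ≤? distinct _≟_ (outputs A₁ᴾ ℓ)

  mode : List RevealP → Mode
  mode ℓ with trusted? ℓ | ffpCheaper? ℓ
  ... | yes _ | _     = usePredictions
  ... | no _  | yes _ = useFFP
  ... | no _  | no _  = useA₁

  mode-usePredictions : ∀ ℓ → mode ℓ ≡ usePredictions → Trusted ℓ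
  mode-usePredictions ℓ with trusted? ℓ | ffpCheaper? ℓ
  ... | yes trusted | _     = λ _ → trusted
  ... | no _        | yes _ = λ ()
  ... | no _        | no _  = λ ()

  mode-useFFP : ∀ ℓ → mode ℓ ≡ useFFP → FFPCheaper ℓ
  mode-useFFP ℓ with trusted? ℓ | ffpCheaper? ℓ
  ... | yes _ | _         = λ ()
  ... | no _  | yes cheap = λ _ → cheap
  ... | no _  | no _      = λ ()

  mode-useA₁ : ∀ ℓ → mode ℓ ≡ useA₁ → ¬ FFPCheaper ℓ
  mode-useA₁ ℓ with trusted? ℓ | ffpCheaper? ℓ
  ... | yes _ | _         = λ ()
  ... | no _  | yes _     = λ ()
  ... | no _  | no dearer = λ _ → dearer

  Trusted⇒usePredictions : ∀ ℓ → Trusted ℓ → mode ℓ ≡ usePredictions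
  Trusted⇒usePredictions ℓ trusted with trusted? ℓ
  ... | yes _         = refl
  ... | no distrusted = contradiction trusted distrusted

  payload : Mode → AlgP ℕ
  payload usePredictions = palette
  payload useFFP         = cantor ∘ FFP
  payload useA₁          = A₁ᴾ

  tagged : AlgP (ℕ × ℕ)
  tagged ℓ = index (mode ℓ) , payload (mode ℓ) ℓ

  A′ : AlgP ℕ
  A′ = cantor ∘ tagged

  tagged-≡ : ∀ {ℓ ℓ′} → tagged ℓ ≡ tagged ℓ′ →
    mode ℓ ≡ mode ℓ′ × payload (mode ℓ) ℓ ≡ payload (mode ℓ) ℓ′
  tagged-≡ {ℓ} {ℓ′} eq =
    same-mode , subst (λ m → payload (mode ℓ) ℓ ≡ payload m ℓ′) (sym same-mode) (cong proj₂ eq)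
    where
    same-mode = index-injective (cong proj₁ eq)

  module Run {n} (G : Graph n) (π : Permutation′ n) (P : Fin n → ℕ) where

    Pπ : Fin n → ℕ
    Pπ t = P (π ⟨$⟩ʳ t)

    adjTo : Fin n → Fin n → Bool
    adjTo t s = adj G (π ⟨$⟩ʳ t) (π ⟨$⟩ʳ s)

    reveal : Fin n → RevealP
    reveal t = revealAt G π t , Pπ t

    history : Fin n → List RevealP
    history t = take (suc (toℕ t)) (inputP G π P)

    ffp : Fin n → ℕ × ℕ
    ffp = runP FFP G π P

    a₁ : Fin n → ℕ
    a₁ = run A₁ G π

    modeAt : Fin n → Mode
    modeAt t = mode (history t)

    inputP≡tabulate : inputP G π P ≡ tabulate reveal
    inputP≡tabulate = map-tabulate id reveal

    outputs-before : ∀ {X : Set} (Φ : AlgP X) m → outputs Φ (take m (inputP G π P)) ≡ take m (tabulate (runP Φ G π P))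
    outputs-before Φ m = trans (outputs-take Φ m _) (cong (take m) (outputs-input inputP≡tabulate))
      where
      outputs-input : ∀ {rs} → rs ≡ tabulate reveal → outputs Φ rs ≡ tabulate (λ i → Φ (take (suc (toℕ i)) rs))
      outputs-input refl = outputs-tabulate Φ reveal

    A₁ᴾ≗a₁ : ∀ t → runP A₁ᴾ G π P t ≡ a₁ t
    A₁ᴾ≗a₁ t = cong A₁ (begin
      map proj₁ (take m (inputP G π P))  ≡⟨ sym (take-map m (inputP G π P)) ⟩
      take m (map proj₁ (inputP G π P))  ≡⟨ cong (take m) (sym (map-∘ (allFin n))) ⟩
      take m (input G π)                 ∎)
      where
      open ≡-Reasoning
      m = suc (toℕ t)

    neighbourColours : Fin n → List (ℕ × ℕ)
    neighbourColours t = nbrColors (take (toℕ t) (tabulate ffp)) (take (toℕ t) (tabulate (adjTo t)))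

    ffp-colour : ∀ t → ffp t ≡ (Pπ t , mex (usedIdx (Pπ t) (neighbourColours t)))
    ffp-colour t = begin
      FFP (take (suc (toℕ t)) (inputP G π P))          ≡⟨ cong FFP history-∷ʳ ⟩
      FFP (earlier-input ∷ʳ reveal t)                   ≡⟨ FFP-∷ʳ earlier-input (reveal t) ⟩
      ffpStep (ffpRun [] earlier-input) (reveal t)      ≡⟨ cong₂ ffpStep earlier-colours (cong (_, Pπ t) revealAt≡) ⟩
      (Pπ t , mex (usedIdx (Pπ t) (neighbourColours t))) ∎
      where
      open ≡-Reasoning
      earlier-input = take (toℕ t) (inputP G π P)
      history-∷ʳ : take (suc (toℕ t)) (inputP G π P) ≡ earlier-input ∷ʳ reveal t
      history-∷ʳ rewrite inputP≡tabulate = take-suc-tabulate reveal t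
      earlier-colours : ffpRun [] earlier-input ≡ take (toℕ t) (tabulate ffp)
      earlier-colours = trans (ffpRun≡outputs earlier-input) (outputs-before FFP (toℕ t))
      revealAt≡ : revealAt G π t ≡ take (toℕ t) (tabulate (adjTo t))
      revealAt≡ = trans (sym (take-map (toℕ t) (allFin n))) (cong (take (toℕ t)) (map-tabulate id (adjTo t)))

    ffp-palette : ∀ t → proj₁ (ffp t) ≡ Pπ t
    ffp-palette t = cong proj₁ (ffp-colour t)

    ffp-proper : ProperOnline G π ffp
    ffp-proper = ProperOnline-from-earlier G π λ s t s<t ts ffps≡ffpt →
      mex-∉ (usedIdx (Pπ t) (neighbourColours t))
        (∈-usedIdx⁺ (neighbourColours t)
          (subst (_∈ neighbourColours t) (trans ffps≡ffpt (ffp-colour t)) (∈-nbrColors⁺ ffp (adjTo t) s<t ts)))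

    ffp-superscript-0 : ∀ t → (∀ s → adjTo t s ≡ true → Pπ s ≢ Pπ t) → proj₂ (ffp t) ≡ 0
    ffp-superscript-0 t palette-differs =
      trans (cong proj₂ (ffp-colour t)) (cong mex (usedIdx-[] (neighbourColours t) otherPalette))
      where
      otherPalette : ∀ {y} → y ∈ neighbourColours t → proj₁ y ≢ Pπ t
      otherPalette y∈ with ∈-nbrColors⁻ {m = toℕ t} ffp (adjTo t) y∈
      ... | s , ts , refl = subst (_≢ Pπ t) (sym (ffp-palette s)) (palette-differs s ts)

    count-history : ∀ {X : Set} (_≟X_ : DecidableEquality X) (Φ : AlgP X) t →
      distinct _≟X_ (outputs Φ (history t)) ≡ distinct _≟X_ (colours-up-to (runP Φ G π P) t)
    count-history _≟X_ Φ t = cong (distinct _≟X_) (outputs-before Φ (suc (toℕ t)))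

    count-history-A₁ : ∀ t → distinct _≟_ (outputs A₁ᴾ (history t)) ≡ distinct _≟_ (colours-up-to a₁ t)
    count-history-A₁ t = trans (count-history _≟_ A₁ᴾ t)
      (cong (λ cs → distinct _≟_ (take (suc (toℕ t)) cs)) (tabulate-cong A₁ᴾ≗a₁))

    payload-proper : ProperOnline G π a₁ → ∀ m s t → adj G (π ⟨$⟩ʳ s) (π ⟨$⟩ʳ t) ≡ true →
      modeAt s ≡ m → modeAt t ≡ m → payload m (history s) ≢ payload m (history t)
    payload-proper _ usePredictions s t st s-mode t-mode same-palette =
      ffp-proper s t st (cong₂ _,_ same-palette (trans (superscript s s-mode) (sym (superscript t t-mode))))
      where
      superscript : ∀ t → modeAt t ≡ usePredictions → proj₂ (ffp t) ≡ 0
      superscript t = proj₁ ∘ mode-usePredictions (history t)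
    payload-proper _ useFFP s t st _ _ = ffp-proper s t st ∘ cantor-injective
    payload-proper a₁-proper useA₁ s t st _ _ same =
      a₁-proper s t st (trans (sym (A₁ᴾ≗a₁ s)) (trans same (A₁ᴾ≗a₁ t)))

    A′-proper : ProperOnline G π a₁ → ProperOnline G π (runP A′ G π P)
    A′-proper a₁-proper s t st same with tagged-≡ (cantor-injective same)
    ... | same-mode , same-payload = payload-proper a₁-proper (modeAt s) s t st refl (sym same-mode) same-payload

    timesIn : Mode → List (Fin n)
    timesIn m = filter (λ t → modeAt t ≟ᴹ m) (allFin n)

    inMode : ∀ m → All (λ t → modeAt t ≡ m) (timesIn m)
    inMode m = all-filter (λ t → modeAt t ≟ᴹ m) (allFin n)

    every-time-in-a-mode : ∀ t → t ∈ timesIn usePredictions ++ timesIn useFFP ++ timesIn useA₁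
    every-time-in-a-mode t = placed (modeAt t) refl
      where
      in-mode : ∀ {m} → modeAt t ≡ m → t ∈ timesIn m
      in-mode = ∈-filter⁺ (λ s → modeAt s ≟ᴹ _) (∈-allFin t)
      placed : ∀ m → modeAt t ≡ m → t ∈ timesIn usePredictions ++ timesIn useFFP ++ timesIn useA₁
      placed usePredictions t-mode = ∈-++⁺ˡ (in-mode t-mode)
      placed useFFP         t-mode = ∈-++⁺ʳ (timesIn usePredictions) (∈-++⁺ˡ (in-mode t-mode))
      placed useA₁          t-mode = ∈-++⁺ʳ (timesIn usePredictions) (∈-++⁺ʳ (timesIn useFFP) (in-mode t-mode))

    taggedAt : Fin n → ℕ × ℕ
    taggedAt = tagged ∘ history

    tagged≤payload : ∀ m →
      distinct decℕ×ℕ (map taggedAt (timesIn m)) ≤ distinct _≟_ (map (payload m ∘ history) (timesIn m))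
    tagged≤payload m = distinct-map-factor _≟_ decℕ×ℕ (payload m ∘ history) (index m ,_) (timesIn m)
      λ {t} t∈ → cong (λ m′ → index m′ , payload m′ (history t)) (All.lookup (inMode m) t∈)

    #FFP #A₁ : ℕ
    #FFP = numColors decℕ×ℕ ffp
    #A₁  = numColors _≟_ a₁

    payload-bound : IsChromatic G k → ProperOnline G π a₁ →
      ∀ m → distinct _≟_ (map (payload m ∘ history) (timesIn m)) ≤ #FFP ⊓ #A₁
    payload-bound χ a₁-proper usePredictions = ≤-trans palettes≤k (⊓-glb k≤#FFP (χ≤numColors G π χ a₁-proper))
      where
      palettes≤k : distinct _≟_ (map (proj₁ ∘ ffp) (timesIn usePredictions)) ≤ k
      palettes≤k = distinct-≤-latest _≟_ (proj₁ ∘ ffp)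
        (λ t t-mode → subst (_≤ k) (count-history _≟_ palette t) (proj₂ (mode-usePredictions (history t) t-mode)))
        (inMode usePredictions)
      k≤#FFP : k ≤ #FFP
      k≤#FFP = ≤-trans (χ≤numColors G π χ λ s t st → ffp-proper s t st ∘ cantor-injective)
                       (distinct-map-factor decℕ×ℕ _≟_ ffp cantor (allFin n) λ _ → refl)
    payload-bound χ a₁-proper useFFP = ⊓-glb
      (≤-trans colours≤ffp (distinct-map≤numColors decℕ×ℕ ffp (timesIn useFFP)))
      (≤-trans colours≤ffp (distinct-≤-latest decℕ×ℕ ffp cheaper (inMode useFFP)))
      where
      colours≤ffp : distinct _≟_ (map (cantor ∘ ffp) (timesIn useFFP)) ≤ distinct decℕ×ℕ (map ffp (timesIn useFFP))
      colours≤ffp = distinct-map-factor decℕ×ℕ _≟_ ffp cantor (timesIn useFFP) λ _ → refl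
      cheaper : ∀ t → modeAt t ≡ useFFP → distinct decℕ×ℕ (colours-up-to ffp t) ≤ #A₁
      cheaper t t-mode = begin
        distinct decℕ×ℕ (colours-up-to ffp t)      ≡⟨ count-history decℕ×ℕ FFP t ⟨
        distinct decℕ×ℕ (outputs FFP (history t))  ≤⟨ mode-useFFP (history t) t-mode ⟩
        distinct _≟_ (outputs A₁ᴾ (history t))     ≡⟨ count-history-A₁ t ⟩
        distinct _≟_ (colours-up-to a₁ t)          ≤⟨ distinct-up-to≤numColors _≟_ a₁ t ⟩
        #A₁                                        ∎
        where open ≤-Reasoning
    payload-bound χ a₁-proper useA₁ = ⊓-glb
      (≤-trans colours≤a₁ (distinct-≤-latest _≟_ a₁ dearer (inMode useA₁)))
      (≤-trans colours≤a₁ (distinct-map≤numColors _≟_ a₁ (timesIn useA₁)))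
      where
      colours≤a₁ :
        distinct _≟_ (map (A₁ᴾ ∘ history) (timesIn useA₁)) ≤ distinct _≟_ (map a₁ (timesIn useA₁))
      colours≤a₁ = distinct-map-factor _≟_ _≟_ a₁ id (timesIn useA₁) λ {t} _ → A₁ᴾ≗a₁ t
      dearer : ∀ t → modeAt t ≡ useA₁ → distinct _≟_ (colours-up-to a₁ t) ≤ #FFP
      dearer t t-mode = begin
        distinct _≟_ (colours-up-to a₁ t)          ≡⟨ count-history-A₁ t ⟨
        distinct _≟_ (outputs A₁ᴾ (history t))     ≤⟨ ≰⇒≥ (mode-useA₁ (history t) t-mode) ⟩
        distinct decℕ×ℕ (outputs FFP (history t))  ≡⟨ count-history decℕ×ℕ FFP t ⟩
        distinct decℕ×ℕ (colours-up-to ffp t)      ≤⟨ distinct-up-to≤numColors decℕ×ℕ ffp t ⟩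
        #FFP                                       ∎
        where open ≤-Reasoning

    A′-colours : IsChromatic G k → ProperOnline G π a₁ → numColors _≟_ (runP A′ G π P) ≤ 3 * (#FFP ⊓ #A₁)
    A′-colours χ a₁-proper = begin
      numColors _≟_ (runP A′ G π P)
        ≤⟨ distinct-map-factor decℕ×ℕ _≟_ taggedAt cantor (allFin n) (λ _ → refl) ⟩
      distinct decℕ×ℕ (map taggedAt (allFin n))
        ≤⟨ distinct-mono decℕ×ℕ {map taggedAt (allFin n)} (map⁺ taggedAt λ {t} _ → every-time-in-a-mode t) ⟩
      distinct decℕ×ℕ (map taggedAt (timesIn usePredictions ++ timesIn useFFP ++ timesIn useA₁))
        ≡⟨ cong (distinct decℕ×ℕ) (trans (map-++ taggedAt (timesIn usePredictions) _)
                                         (cong (byMode usePredictions ++_) (map-++ taggedAt (timesIn useFFP) _))) ⟩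
      distinct decℕ×ℕ (byMode usePredictions ++ byMode useFFP ++ byMode useA₁)
        ≤⟨ ≤-trans (distinct-++ decℕ×ℕ (byMode usePredictions) _)
                   (+-monoʳ-≤ _ (distinct-++ decℕ×ℕ (byMode useFFP) _)) ⟩
      #byMode usePredictions + (#byMode useFFP + #byMode useA₁)
        ≤⟨ +-mono-≤ (mode-bound _) (+-mono-≤ (mode-bound _) (≤-trans (mode-bound _) (m≤m+n _ 0))) ⟩
      3 * (#FFP ⊓ #A₁)
        ∎
      where
      open ≤-Reasoning
      byMode : Mode → List (ℕ × ℕ)
      byMode m = map taggedAt (timesIn m)
      #byMode : Mode → ℕ
      #byMode m = distinct decℕ×ℕ (byMode m)
      mode-bound : ∀ m → #byMode m ≤ #FFP ⊓ #A₁
      mode-bound m = ≤-trans (tagged≤payload m) (payload-bound χ a₁-proper m)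

    perfect⇒usePredictions : Proper G P → numColors _≟_ P ≤ k → ∀ t → modeAt t ≡ usePredictions
    perfect⇒usePredictions proper few t = Trusted⇒usePredictions (history t) (superscript-0 , palettes≤k)
      where
      superscript-0 : proj₂ (ffp t) ≡ 0
      superscript-0 = ffp-superscript-0 t λ s ts → proper (π ⟨$⟩ʳ t) (π ⟨$⟩ʳ s) ts ∘ sym
      palettes≤k : distinct _≟_ (outputs palette (history t)) ≤ k
      palettes≤k = begin
        distinct _≟_ (outputs palette (history t))    ≡⟨ count-history _≟_ palette t ⟩
        distinct _≟_ (colours-up-to (proj₁ ∘ ffp) t)  ≤⟨ distinct-up-to≤numColors _≟_ (proj₁ ∘ ffp) t ⟩
        numColors _≟_ (proj₁ ∘ ffp)                   ≡⟨ cong (distinct _≟_) (map-cong ffp-palette (allFin n)) ⟩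
        numColors _≟_ Pπ                              ≤⟨ numColors-∘-≤ _≟_ P (π ⟨$⟩ʳ_) ⟩
        numColors _≟_ P                               ≤⟨ few ⟩
        k                                             ∎
        where open ≤-Reasoning

    A′-colours-perfect : Proper G P → numColors _≟_ P ≤ k → numColors _≟_ (runP A′ G π P) ≤ k
    A′-colours-perfect proper few = begin
      numColors _≟_ (runP A′ G π P)
        ≤⟨ distinct-map-factor _≟_ _≟_ Pπ (λ c → cantor (0 , c)) (allFin n) (λ {t} _ → predicted-colour t) ⟩
      numColors _≟_ Pπ               ≤⟨ numColors-∘-≤ _≟_ P (π ⟨$⟩ʳ_) ⟩
      numColors _≟_ P                ≤⟨ few ⟩
      k                              ∎
      where
      open ≤-Reasoning
      predicted-colour : ∀ t → runP A′ G π P t ≡ cantor (0 , Pπ t)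
      predicted-colour t =
        trans (cong (λ m → cantor (index m , payload m (history t))) (perfect⇒usePredictions proper few t))
              (cong (λ c → cantor (0 , c)) (ffp-palette t))

corollary2 : (k : ℕ) (𝒞 : GraphClass) →
    (∀ n (G : Graph n) → 𝒞 n G → IsChromatic G k) →
    (A₁ : Alg ℕ) →
    (∀ n (G : Graph n) (π : Permutation′ n) → 𝒞 n G → ProperOnline G π (run A₁ G π)) →
    Σ (AlgP ℕ) λ A′ →
      ∀ n (G : Graph n) (π : Permutation′ n) (P : Fin n → ℕ) → 𝒞 n G →
        ProperOnline G π (runP A′ G π P)
        × (∀ e → IsEta G P e →
             (0 < e → numColors _≟ℕ_ (runP A′ G π P)
                        ≤ 3 * (numColors decℕ×ℕ (runP FFP G π P) ⊓ numColors _≟ℕ_ (run A₁ G π)))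
             × (e ≡ 0 → numColors _≟ℕ_ (runP A′ G π P) ≡ k))
corollary2 k 𝒞 chromatic A₁ A₁-proper = A′ , λ n G π P G∈𝒞 →
  let open Run G π P
      χ = chromatic n G G∈𝒞
      a₁-proper = A₁-proper n G π G∈𝒞
  in A′-proper a₁-proper ,
     λ { e ((O , optimal , mismatches≡e) , _) →
           (λ _ → A′-colours χ a₁-proper) ,
           λ e≡0 → let (P-proper , P-few) = perfect-predictions {G = G} {P} {O} χ optimal (trans mismatches≡e e≡0)
                   in ≤-antisym (A′-colours-perfect P-proper P-few) (χ≤numColors G π χ (A′-proper a₁-proper)) }
  where open Combined k A₁
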